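{- Markov's principle is equivalent over $\mathsf{HA}$ to the rule $\mathsf{EM}^-$: (i) for every atomic formula $\mathsf P$, $\neg\forall\alpha\,\mathsf P\to\exists\alpha\,\mathsf P^\perp$ is derivable in $\mathsf{HA}+\mathsf{EM}^-$; (ii) in $\mathsf{HA}$ extended with all instances of the axiom $\textsc{mrk}$: $\neg\forall\alpha\,\mathsf Q\to\exists\alpha\,\mathsf Q^\perp$ ($\mathsf Q$ atomic), the rule $\mathsf{EM}^-$ is derivable, i.e. for every formula $A$ and atomic $\mathsf P$, whenever $\Gamma,A\vdash\exists\alpha\mathsf P$ and $\Gamma,\neg A\vdash\exists\alpha\mathsf P$ are derivable, then $\Gamma\vdash\exists\alpha\mathsf P$ is derivable.
   Context: $\mathsf{HA}$ is intuitionistic (Heyting) arithmetic in natural deduction, with decidable atomic formulas; for atomic $\mathsf P$, $\mathsf P^\perp$ is its atomic complement, and $\neg A:=A\to\bot$. The rule $\mathsf{EM}^-$: for an arbitrary formula $A$ and atomic $\mathsf P$, from derivations of $\Gamma,A\vdash\exists x\mathsf P$ and $\Gamma,\neg A\vdash\exists x\mathsf P$, discharging the assumptions $A$ and $\neg A$, infer $\Gamma\vdash\exists x\mathsf P$. $\mathsf{HA}+\mathsf{EM}^-$ is $\mathsf{HA}$ with this rule added. -}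

module Defs where

open import Data.Nat using (ℕ; zero; suc)
open import Data.List using (List; []; _∷_; map)
open import Data.List.Membership.Propositional using (_∈_)
open import Data.Unit using (⊤)
open import Data.Empty using (⊥)

data Term : Set where
  var  : ℕ → Term
  `0   : Term
  `S   : Term → Term
  _`+_ : Term → Term → Term
  _`*_ : Term → Term → Term

data Atom : Set where
  _≐_ : Term → Term → Atom
  _≢_ : Term → Term → Atom

_ᶜ : Atom → Atom
(t ≐ u) ᶜ = t ≢ u
(t ≢ u) ᶜ = t ≐ u

infixr 6 _∧'_
infixr 5 _∨'_
infixr 4 _⇒_

data Formula : Set where
  atom : Atom → Formula
  ⊥'   : Formula
  _∧'_ : Formula → Formula → Formula
  _∨'_ : Formula → Formula → Formula
  _⇒_  : Formula → Formula → Formula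
  ∀'   : Formula → Formula      -- binds variable 0
  ∃'   : Formula → Formula      -- binds variable 0

¬' : Formula → Formula
¬' A = A ⇒ ⊥'

Subst : Set
Subst = ℕ → Term

tsub : Subst → Term → Term
tsub σ (var n)   = σ n
tsub σ `0        = `0
tsub σ (`S t)    = `S (tsub σ t)
tsub σ (t `+ u)  = tsub σ t `+ tsub σ u
tsub σ (t `* u)  = tsub σ t `* tsub σ u

tshift : Term → Term
tshift = tsub (λ n → var (suc n))

lift : Subst → Subst
lift σ zero    = var zero
lift σ (suc n) = tshift (σ n)

asub : Subst → Atom → Atom
asub σ (t ≐ u) = tsub σ t ≐ tsub σ u
asub σ (t ≢ u) = tsub σ t ≢ tsub σ u

fsub : Subst → Formula → Formula
fsub σ (atom P) = atom (asub σ P)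
fsub σ ⊥'       = ⊥'
fsub σ (A ∧' B) = fsub σ A ∧' fsub σ B
fsub σ (A ∨' B) = fsub σ A ∨' fsub σ B
fsub σ (A ⇒ B)  = fsub σ A ⇒ fsub σ B
fsub σ (∀' A)   = ∀' (fsub (lift σ) A)
fsub σ (∃' A)   = ∃' (fsub (lift σ) A)

shift : Formula → Formula
shift = fsub (λ n → var (suc n))

sub0 : Term → Subst
sub0 t zero    = t
sub0 t (suc n) = var n

_[_] : Formula → Term → Formula
A [ t ] = fsub (sub0 t) A

succ0 : Subst
succ0 zero    = `S (var zero)
succ0 (suc n) = var (suc n)

-- Non-logical axioms of HA (open formulas; free variables are
-- implicitly universally quantified)

data HAAxiom : Formula → Set where
  eq-refl  : ∀ t → HAAxiom (atom (t ≐ t))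
  eq-subst : ∀ t u A → HAAxiom (atom (t ≐ u) ⇒ A [ t ] ⇒ A [ u ])
  S≢0      : ∀ t → HAAxiom (¬' (atom (`S t ≐ `0)))
  S-inj    : ∀ t u → HAAxiom (atom (`S t ≐ `S u) ⇒ atom (t ≐ u))
  plus-0   : ∀ t → HAAxiom (atom ((t `+ `0) ≐ t))
  plus-S   : ∀ t u → HAAxiom (atom ((t `+ `S u) ≐ `S (t `+ u)))
  times-0  : ∀ t → HAAxiom (atom ((t `* `0) ≐ `0))
  times-S  : ∀ t u → HAAxiom (atom ((t `* `S u) ≐ ((t `* u) `+ t)))
  neq-⊥    : ∀ t u → HAAxiom (atom (t ≢ u) ⇒ atom (t ≐ u) ⇒ ⊥')
  eq-dec   : ∀ t u → HAAxiom (atom (t ≐ u) ∨' atom (t ≢ u))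
  induction : ∀ A → HAAxiom
    (A [ `0 ] ∧' ∀' (A ⇒ fsub succ0 A) ⇒ ∀' A)

-- Natural deduction for HA, parametrised by
--   EMon : a proposition enabling the rule EM⁻ (⊤ = on, ⊥ = off)
--   Ax   : additional axioms

data Deriv (EMon : Set) (Ax : Formula → Set) : List Formula → Formula → Set where
  hyp  : ∀ {Γ A} → A ∈ Γ → Deriv EMon Ax Γ A
  ax   : ∀ {Γ A} → Ax A → Deriv EMon Ax Γ A
  haAx : ∀ {Γ A} → HAAxiom A → Deriv EMon Ax Γ A
  ⊥E   : ∀ {Γ A} → Deriv EMon Ax Γ ⊥' → Deriv EMon Ax Γ A
  ∧I   : ∀ {Γ A B} → Deriv EMon Ax Γ A → Deriv EMon Ax Γ B → Deriv EMon Ax Γ (A ∧' B)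
  ∧E₁  : ∀ {Γ A B} → Deriv EMon Ax Γ (A ∧' B) → Deriv EMon Ax Γ A
  ∧E₂  : ∀ {Γ A B} → Deriv EMon Ax Γ (A ∧' B) → Deriv EMon Ax Γ B
  ∨I₁  : ∀ {Γ A B} → Deriv EMon Ax Γ A → Deriv EMon Ax Γ (A ∨' B)
  ∨I₂  : ∀ {Γ A B} → Deriv EMon Ax Γ B → Deriv EMon Ax Γ (A ∨' B)
  ∨E   : ∀ {Γ A B C} → Deriv EMon Ax Γ (A ∨' B) → Deriv EMon Ax (A ∷ Γ) C
         → Deriv EMon Ax (B ∷ Γ) C → Deriv EMon Ax Γ C
  ⇒I   : ∀ {Γ A B} → Deriv EMon Ax (A ∷ Γ) B → Deriv EMon Ax Γ (A ⇒ B)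
  ⇒E   : ∀ {Γ A B} → Deriv EMon Ax Γ (A ⇒ B) → Deriv EMon Ax Γ A → Deriv EMon Ax Γ B
  ∀I   : ∀ {Γ A} → Deriv EMon Ax (map shift Γ) A → Deriv EMon Ax Γ (∀' A)
  ∀E   : ∀ {Γ A} → Deriv EMon Ax Γ (∀' A) → (t : Term) → Deriv EMon Ax Γ (A [ t ])
  ∃I   : ∀ {Γ A} (t : Term) → Deriv EMon Ax Γ (A [ t ]) → Deriv EMon Ax Γ (∃' A)
  ∃E   : ∀ {Γ A C} → Deriv EMon Ax Γ (∃' A) → Deriv EMon Ax (A ∷ map shift Γ) (shift C)
         → Deriv EMon Ax Γ C
  EM⁻  : ∀ {Γ A} {P : Atom} → EMon
         → Deriv EMon Ax (A ∷ Γ) (∃' (atom P))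
         → Deriv EMon Ax (¬' A ∷ Γ) (∃' (atom P))
         → Deriv EMon Ax Γ (∃' (atom P))

data NoAx : Formula → Set where

data Mrk : Formula → Set where
  mrk : (Q : Atom) → Mrk (¬' (∀' (atom Q)) ⇒ ∃' (atom (Q ᶜ)))

_⊢EM_ : List Formula → Formula → Set
Γ ⊢EM A = Deriv ⊤ NoAx Γ A

_⊢MRK_ : List Formula → Formula → Set
Γ ⊢MRK A = Deriv ⊥ Mrk Γ A

-- (i) Given ¬∀P, apply EM⁻ to A := ∃P^⊥: the case A is the goal, and in the case ¬A
-- every instance of P follows from decidability of atoms, contradicting ¬∀P.
-- (ii) The two premises of EM⁻ give ¬¬∃P (from A → ∃P we get ¬∃P → ¬A, and then ∃P
-- from ¬A → ∃P); since ∀P^⊥ refutes ∃P this yields ¬∀P^⊥, and Markov's axiom for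
-- P^⊥ concludes ∃P^⊥⊥ = ∃P.
module Submission where

open import Defs
open import Data.Nat using (zero; suc)
open import Data.List using (List; []; _∷_)
open import Data.List.Relation.Unary.Any using (here; there)
open import Data.Product using (_×_; _,_)
open import Data.Unit using (tt)
open import Relation.Binary.PropositionalEquality using (_≡_; refl; sym; cong; cong₂; subst)

shiftₛ : Subst
shiftₛ n = var (suc n)

tsub-sub0-var0-lift-shift : ∀ t → tsub (sub0 (var zero)) (tsub (lift shiftₛ) t) ≡ t
tsub-sub0-var0-lift-shift (var zero)    = refl
tsub-sub0-var0-lift-shift (var (suc n)) = refl
tsub-sub0-var0-lift-shift `0            = refl
tsub-sub0-var0-lift-shift (`S t)        = cong `S (tsub-sub0-var0-lift-shift t)
tsub-sub0-var0-lift-shift (t `+ u)      =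
  cong₂ _`+_ (tsub-sub0-var0-lift-shift t) (tsub-sub0-var0-lift-shift u)
tsub-sub0-var0-lift-shift (t `* u)      =
  cong₂ _`*_ (tsub-sub0-var0-lift-shift t) (tsub-sub0-var0-lift-shift u)

fsub-lift-shift-atom-[var0] : ∀ Q → fsub (lift shiftₛ) (atom Q) [ var zero ] ≡ atom Q
fsub-lift-shift-atom-[var0] (t ≐ u) =
  cong₂ (λ a b → atom (a ≐ b)) (tsub-sub0-var0-lift-shift t) (tsub-sub0-var0-lift-shift u)
fsub-lift-shift-atom-[var0] (t ≢ u) =
  cong₂ (λ a b → atom (a ≢ b)) (tsub-sub0-var0-lift-shift t) (tsub-sub0-var0-lift-shift u)

ᶜ-involutive : ∀ P → (P ᶜ) ᶜ ≡ P
ᶜ-involutive (t ≐ u) = refl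
ᶜ-involutive (t ≢ u) = refl

Markov : Atom → Formula
Markov Q = ¬' (∀' (atom Q)) ⇒ ∃' (atom (Q ᶜ))

module DerivedRules {E : Set} {Ax : Formula → Set} where

  infix 2 _⊢_
  _⊢_ : List Formula → Formula → Set
  _⊢_ = Deriv E Ax

  atom-dec : ∀ {Γ} P → Γ ⊢ atom P ∨' atom (P ᶜ)
  atom-dec (t ≐ u) = haAx (eq-dec t u)
  atom-dec (t ≢ u) = ∨E (haAx (eq-dec t u)) (∨I₂ (hyp (here refl))) (∨I₁ (hyp (here refl)))

  atom-contradiction : ∀ {Γ} P → Γ ⊢ atom P → Γ ⊢ atom (P ᶜ) → Γ ⊢ ⊥'
  atom-contradiction (t ≐ u) p q = ⇒E (⇒E (haAx (neq-⊥ t u)) q) p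
  atom-contradiction (t ≢ u) p q = ⇒E (⇒E (haAx (neq-⊥ t u)) p) q

  -- In a context shifted under a binder, variable 0 is fresh: these rules instantiate
  -- the shifted quantifier by it.
  ∀E-fresh : ∀ {Γ} Q → Γ ⊢ shift (∀' (atom Q)) → Γ ⊢ atom Q
  ∀E-fresh Q d = subst (_⊢_ _) (fsub-lift-shift-atom-[var0] Q) (∀E d (var zero))

  ∃I-fresh : ∀ {Γ} Q → Γ ⊢ atom Q → Γ ⊢ shift (∃' (atom Q))
  ∃I-fresh Q d = ∃I (var zero) (subst (_⊢_ _) (sym (fsub-lift-shift-atom-[var0] Q)) d)

  ∀ᶜ⇒¬∃ : ∀ {Γ} P → Γ ⊢ ∀' (atom (P ᶜ)) ⇒ ¬' (∃' (atom P))
  ∀ᶜ⇒¬∃ P = ⇒I (⇒I (∃E (hyp (here refl))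
    (atom-contradiction P (hyp (here refl)) (∀E-fresh (P ᶜ) (hyp (there (there (here refl))))))))

  ¬¬-by-cases : ∀ {Γ} A B → Γ ⊢ (¬' A ⇒ B) ⇒ (A ⇒ B) ⇒ ¬' (¬' B)
  ¬¬-by-cases A B = ⇒I (⇒I (⇒I
    (⇒E ¬B (⇒E (hyp (there (there (here refl))))
      (⇒I (⇒E (hyp (there (here refl)))
        (⇒E (hyp (there (there (here refl)))) (hyp (here refl)))))))))
    where ¬B = hyp (here refl)

  ¬¬∃⇒¬∀ᶜ : ∀ {Γ} P → Γ ⊢ ¬' (¬' (∃' (atom P))) ⇒ ¬' (∀' (atom (P ᶜ)))
  ¬¬∃⇒¬∀ᶜ P = ⇒I (⇒I (⇒E (hyp (there (here refl))) (⇒E (∀ᶜ⇒¬∃ P) (hyp (here refl)))))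

  markov-from-EM⁻ : ∀ {Γ} → E → ∀ P → Γ ⊢ Markov P
  markov-from-EM⁻ e P = ⇒I (EM⁻ {A = ∃' (atom (P ᶜ))} e (hyp (here refl))
    (⊥E (⇒E ¬∀P (∀I (∨E (atom-dec P) (hyp (here refl))
      (⊥E (⇒E (hyp (there (here refl))) (∃I-fresh (P ᶜ) (hyp (here refl))))))))))
    where ¬∀P = hyp (there (here refl))

  EM⁻-from-markov : (∀ {Δ} Q → Δ ⊢ Markov Q)
    → ∀ {Γ} A P → A ∷ Γ ⊢ ∃' (atom P) → ¬' A ∷ Γ ⊢ ∃' (atom P) → Γ ⊢ ∃' (atom P)
  EM⁻-from-markov markov A P d₁ d₂ =
    subst (λ Q → _ ⊢ ∃' (atom Q)) (ᶜ-involutive P) (⇒E (markov (P ᶜ)) ¬∀Pᶜ)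
    where
    ¬∀Pᶜ = ⇒E (¬¬∃⇒¬∀ᶜ P) (⇒E (⇒E (¬¬-by-cases A (∃' (atom P))) (⇒I d₂)) (⇒I d₁))

open DerivedRules

mainTheorem7 : ((P : Atom) → [] ⊢EM (¬' (∀' (atom P)) ⇒ ∃' (atom (P ᶜ))))
    × ((Γ : List Formula) (A : Formula) (P : Atom)
    → (A ∷ Γ) ⊢MRK ∃' (atom P) → (¬' A ∷ Γ) ⊢MRK ∃' (atom P) → Γ ⊢MRK ∃' (atom P))
mainTheorem7 = markov-from-EM⁻ tt , λ Γ → EM⁻-from-markov (λ Q → ax (mrk Q))
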